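{- Let $\Delta$ be a simplicial complex, let $s(\Delta)$ be the minimal cardinality of a facet of $\Delta$, and let $i$ be a positive integer with $i\le s(\Delta)$. If $N_i(\Delta)$ is connected, then the $1$-skeleton $\Delta^{(1)}$ is an $i$-connected graph.
   Context: With facets $A_1,\dots,A_r$ of $\Delta$, $N_i(\Delta)=\{F\subseteq[r] : |\bigcap_{l\in F}A_l|\ge i\}$ is the $i$-th nerve complex. $\Delta^{(1)}$ is the graph consisting of the vertices and edges of $\Delta$. A graph is called $i$-connected if it remains connected after deleting any set of at most $i-1$ vertices. -}

module Defs where

open import Data.Nat using (ℕ; zero; suc; _≤_; _<_)
open import Data.Fin using (Fin; zero; suc)
open import Data.Fin.Subset using (Subset; _∈_; _∉_; _⊆_; _∩_; _∪_; ⁅_⁆; ⊤; ∣_∣)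
open import Data.Vec using (_∷_; [])
open import Data.Bool using (true; false)
open import Data.Product using (Σ; ∃; _×_)
open import Relation.Binary.PropositionalEquality using (_≡_; _≢_)
open import Relation.Binary.Construct.Closure.ReflexiveTransitive using (Star)

-- A finite abstract simplicial complex on the ground set Fin n, presented by
-- its list of facets A : Fin r → Subset n.  The faces are the subsets of facets.
IsFacetList : {n r : ℕ} → (Fin r → Subset n) → Set
IsFacetList {n} {r} A = (l m : Fin r) → A l ⊆ A m → l ≡ m

Face : {n r : ℕ} → (Fin r → Subset n) → Subset n → Set
Face {n} {r} A σ = ∃ λ (l : Fin r) → σ ⊆ A l

IsMinFacetSize : {n r : ℕ} → (Fin r → Subset n) → ℕ → Set
IsMinFacetSize {n} {r} A s = (∃ λ (l : Fin r) → ∣ A l ∣ ≡ s) × ((l : Fin r) → s ≤ ∣ A l ∣)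

-- ⋂_{l ∈ F} A_l  (the empty intersection is the whole ground set).
⋂ᶠ : {n r : ℕ} → (Fin r → Subset n) → Subset r → Subset n
⋂ᶠ {n} {zero} A [] = ⊤
⋂ᶠ {n} {suc r} A (true ∷ F) = A zero ∩ ⋂ᶠ (λ l → A (suc l)) F
⋂ᶠ {n} {suc r} A (false ∷ F) = ⋂ᶠ (λ l → A (suc l)) F

NerveFace : {n r : ℕ} → ℕ → (Fin r → Subset n) → Subset r → Set
NerveFace {n} {r} i A F = i ≤ ∣ ⋂ᶠ A F ∣

SkVertex : {m : ℕ} → (Subset m → Set) → Fin m → Set
SkVertex K v = K ⁅ v ⁆

SkEdge : {m : ℕ} → (Subset m → Set) → Fin m → Fin m → Set
SkEdge K u v = u ≢ v × K (⁅ u ⁆ ∪ ⁅ v ⁆)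

WalkIn : {m : ℕ} → (Fin m → Set) → (Fin m → Fin m → Set) → Fin m → Fin m → Set
WalkIn V E = Star (λ x y → V x × V y × E x y)

GraphConnected : {m : ℕ} → (Fin m → Set) → (Fin m → Fin m → Set) → Set
GraphConnected {m} V E =
  (∃ λ (x : Fin m) → V x) × ((x y : Fin m) → V x → V y → WalkIn V E x y)

ComplexConnected : {m : ℕ} → (Subset m → Set) → Set
ComplexConnected K = GraphConnected (SkVertex K) (SkEdge K)

DelVertex : {m : ℕ} → (Fin m → Set) → Subset m → Fin m → Set
DelVertex V S v = V v × v ∉ S

IConnected : {m : ℕ} → ℕ → (Fin m → Set) → (Fin m → Fin m → Set) → Set
IConnected {m} i V E =
  (S : Subset m) → ((v : Fin m) → v ∈ S → V v) → suc ∣ S ∣ ≤ i →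
  GraphConnected (DelVertex V S) E

module Submission where

-- Fix a set S of fewer than i vertices and look at the skeleton with S
-- deleted.  Two observations carry the proof.
--   * Every facet minus S is a clique of that graph, so two surviving
--     vertices of a common facet are joined by a walk of length ≤ 1.
--   * If facets A_l, A_m are adjacent in N_i(Δ), then |A_l ∩ A_m| ≥ i > |S|,
--     so they share a vertex outside S.
-- Hence a walk l → m in N_i(Δ) lifts, facet by facet, to a walk between any
-- surviving vertices of A_l and A_m.  Since every facet has at least
-- s(Δ) ≥ i elements, every facet is a vertex of N_i(Δ) and still has a
-- vertex outside S; this gives nonemptiness, and connectivity of N_i(Δ)
-- gives the walks.

open import Defs
open import Data.Nat using (ℕ; suc; _≤_; _<_)
open import Data.Nat.Properties using (≤-trans; <⇒≱)
open import Data.Fin using (Fin; zero; suc)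
open import Data.Fin.Properties using (any?) renaming (_≟_ to _≟ᶠ_)
open import Data.Fin.Subset using (Subset; _∈_; _∉_; _⊆_; _∪_; ⁅_⁆; ∣_∣)
open import Data.Fin.Subset.Properties
  using (_∈?_; ∈⊤; x∈⁅x⁆; x∈⁅y⁆⇒x≡y; p⊆q⇒∣p∣≤∣q∣; x∈p∩q⁺; x∈p∩q⁻; x∈p∪q⁻; x∈p∪q⁺)
open import Data.Vec using (_∷_; []; here; there)
open import Data.Bool using (true; false)
open import Data.Product using (∃; _×_; _,_; proj₁; proj₂)
open import Data.Sum using (inj₁; inj₂)
open import Data.Empty using (⊥-elim)
open import Relation.Nullary using (yes; no)
open import Relation.Nullary.Decidable using (_×-dec_; ¬?)
open import Relation.Binary.PropositionalEquality using (refl; sym; subst)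
open import Relation.Binary.Construct.Closure.ReflexiveTransitive using (ε; _◅_; _◅◅_)

∈⋂⁻ : ∀ {n r} (A : Fin r → Subset n) (F : Subset r) {x} →
      x ∈ ⋂ᶠ A F → ∀ {l} → l ∈ F → x ∈ A l
∈⋂⁻ A (true ∷ F) x∈ here = proj₁ (x∈p∩q⁻ _ _ x∈)
∈⋂⁻ A (true ∷ F) x∈ (there l∈F) = ∈⋂⁻ (λ l → A (suc l)) F (proj₂ (x∈p∩q⁻ _ _ x∈)) l∈F
∈⋂⁻ A (false ∷ F) x∈ (there l∈F) = ∈⋂⁻ (λ l → A (suc l)) F x∈ l∈F

∈⋂⁺ : ∀ {n r} (A : Fin r → Subset n) (F : Subset r) {x} →
      (∀ l → l ∈ F → x ∈ A l) → x ∈ ⋂ᶠ A F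
∈⋂⁺ A [] _ = ∈⊤
∈⋂⁺ A (true ∷ F) h =
  x∈p∩q⁺ (h zero here , ∈⋂⁺ (λ l → A (suc l)) F (λ l l∈F → h (suc l) (there l∈F)))
∈⋂⁺ A (false ∷ F) h = ∈⋂⁺ (λ l → A (suc l)) F (λ l l∈F → h (suc l) (there l∈F))

⊆⋂⁅⁆ : ∀ {n r} (A : Fin r → Subset n) (l : Fin r) → A l ⊆ ⋂ᶠ A ⁅ l ⁆
⊆⋂⁅⁆ A l x∈A = ∈⋂⁺ A ⁅ l ⁆ λ k k∈⁅l⁆ → subst (λ m → _ ∈ A m) (sym (x∈⁅y⁆⇒x≡y l k∈⁅l⁆)) x∈A

⁅⁆⊆ : ∀ {n} {x : Fin n} {B : Subset n} → x ∈ B → ⁅ x ⁆ ⊆ B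
⁅⁆⊆ {x = x} x∈B y∈⁅x⁆ with x∈⁅y⁆⇒x≡y x y∈⁅x⁆
... | refl = x∈B

⁅⁆∪⁅⁆⊆ : ∀ {n} {x y : Fin n} {B : Subset n} → x ∈ B → y ∈ B → ⁅ x ⁆ ∪ ⁅ y ⁆ ⊆ B
⁅⁆∪⁅⁆⊆ {x = x} {y} x∈B y∈B z∈ with x∈p∪q⁻ ⁅ x ⁆ ⁅ y ⁆ z∈
... | inj₁ z∈⁅x⁆ = ⁅⁆⊆ x∈B z∈⁅x⁆
... | inj₂ z∈⁅y⁆ = ⁅⁆⊆ y∈B z∈⁅y⁆

∃-outside : ∀ {n} (S B : Subset n) → ∣ S ∣ < ∣ B ∣ → ∃ λ x → x ∈ B × x ∉ S
∃-outside S B ∣S∣<∣B∣ with any? (λ x → (x ∈? B) ×-dec ¬? (x ∈? S))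
... | yes found = found
... | no none = ⊥-elim (<⇒≱ ∣S∣<∣B∣ (p⊆q⇒∣p∣≤∣q∣ B⊆S))
  where
  B⊆S : B ⊆ S
  B⊆S {x} x∈B with x ∈? S
  ... | yes x∈S = x∈S
  ... | no x∉S = ⊥-elim (none (x , x∈B , x∉S))

module DeletedSkeleton {n r : ℕ} (A : Fin r → Subset n) (S : Subset n) where

  V : Fin n → Set
  V = DelVertex (SkVertex (Face A)) S

  E : Fin n → Fin n → Set
  E = SkEdge (Face A)

  vertex-in-facet : ∀ {x} → SkVertex (Face A) x → ∃ λ l → x ∈ A l
  vertex-in-facet {x} (l , ⁅x⁆⊆A) = l , ⁅x⁆⊆A (x∈⁅x⁆ x)

  survives : ∀ {x l} → x ∈ A l → x ∉ S → V x
  survives {l = l} x∈A x∉S = (l , ⁅⁆⊆ x∈A) , x∉S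

  facet-clique : ∀ {x y l} → x ∈ A l → x ∉ S → y ∈ A l → y ∉ S → WalkIn V E x y
  facet-clique {x} {y} {l} x∈A x∉S y∈A y∉S with x ≟ᶠ y
  ... | yes refl = ε
  ... | no x≢y =
    (survives x∈A x∉S , survives y∈A y∉S , x≢y , l , ⁅⁆∪⁅⁆⊆ x∈A y∈A) ◅ ε

module NerveLifting {n r : ℕ} (A : Fin r → Subset n) (i : ℕ)
                    (S : Subset n) (∣S∣<i : suc ∣ S ∣ ≤ i) where
  open DeletedSkeleton A S

  N : Subset r → Set
  N = NerveFace i A

  common-point : ∀ F → N F → ∃ λ z → z ∈ ⋂ᶠ A F × z ∉ S
  common-point F i≤∣⋂F∣ = ∃-outside S (⋂ᶠ A F) (≤-trans ∣S∣<i i≤∣⋂F∣)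

  -- Induction on the nerve walk: cross each nerve edge {l, l'} through a
  -- common point of A_l and A_l' outside S, moving within facets by cliques.
  lift-walk : ∀ {l m} → WalkIn (SkVertex N) (SkEdge N) l m →
              ∀ {x y} → x ∈ A l → x ∉ S → y ∈ A m → y ∉ S → WalkIn V E x y
  lift-walk ε x∈A x∉S y∈A y∉S = facet-clique x∈A x∉S y∈A y∉S
  lift-walk {l} (_◅_ {j = l′} (_ , _ , _ , edge) rest) x∈A x∉S y∈A y∉S
    with common-point (⁅ l ⁆ ∪ ⁅ l′ ⁆) edge
  ... | z , z∈⋂ , z∉S =
    facet-clique x∈A x∉S (∈⋂⁻ A _ z∈⋂ (x∈p∪q⁺ (inj₁ (x∈⁅x⁆ l)))) z∉S
    ◅◅ lift-walk rest (∈⋂⁻ A _ z∈⋂ (x∈p∪q⁺ (inj₂ (x∈⁅x⁆ l′)))) z∉S y∈A y∉S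

facet-in-nerve : ∀ {n r} (A : Fin r → Subset n) {s i : ℕ} →
                 IsMinFacetSize A s → i ≤ s → ∀ l → NerveFace i A ⁅ l ⁆
facet-in-nerve A (_ , s≤∣A∣) i≤s l =
  ≤-trans i≤s (≤-trans (s≤∣A∣ l) (p⊆q⇒∣p∣≤∣q∣ (⊆⋂⁅⁆ A l)))

lemma3p4 : (n r : ℕ) (A : Fin r → Subset n) → IsFacetList A →
    (s : ℕ) → IsMinFacetSize A s →
    (i : ℕ) → 1 ≤ i → i ≤ s →
    ComplexConnected (NerveFace i A) →
    IConnected i (SkVertex (Face A)) (SkEdge (Face A))
lemma3p4 n r A _ s minSize i _ i≤s ((l₀ , _) , nerveWalk) S _ ∣S∣<i =
  nonempty , connected
  where
  open DeletedSkeleton A S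
  open NerveLifting A i S ∣S∣<i

  inNerve : ∀ l → N ⁅ l ⁆
  inNerve = facet-in-nerve A minSize i≤s

  nonempty : ∃ V
  nonempty with common-point ⁅ l₀ ⁆ (inNerve l₀)
  ... | z , z∈⋂ , z∉S = z , survives (∈⋂⁻ A _ z∈⋂ (x∈⁅x⁆ l₀)) z∉S

  connected : ∀ x y → V x → V y → WalkIn V E x y
  connected x y (vx , x∉S) (vy , y∉S) with vertex-in-facet vx | vertex-in-facet vy
  ... | l , x∈A | m , y∈A =
    lift-walk (nerveWalk l m (inNerve l) (inNerve m)) x∈A x∉S y∈A y∉S
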